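{- Let $n>2k\geq 2$ be integers. Every resolving set for the Kneser graph $K(n,k)$ is also a resolving set for the Johnson graph $J(n,k)$. Consequently $\beta(J(n,k))\leq \beta(K(n,k))$.
   Context: For a finite connected graph $G$ with distance $d$, a vertex $x$ resolves a pair $u,v$ if $d(u,x)\neq d(v,x)$; a set $S\subseteq V(G)$ is a resolving set if every pair of distinct vertices is resolved by some vertex of $S$; the metric dimension $\beta(G)$ is the minimum size of a resolving set. For $n>k$, the Johnson graph $J(n,k)$ has as vertices the $k$-subsets of $[n]=\{1,\dots,n\}$, two being adjacent when their intersection has size $k-1$. The Kneser graph $K(n,k)$ has the same vertex set, two $k$-subsets being adjacent when they are disjoint (it is connected for $n>2k$). -}

module Defs where

open import Level using (0ℓ)
open import Data.Nat using (ℕ; zero; suc; _∸_; _≤_; _<_)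
open import Data.Fin.Subset using (Subset; _∩_; ∣_∣; ⊥)
open import Data.Product using (Σ; _×_; ∃; ∃-syntax; proj₁)
open import Data.List using (List; length)
open import Data.List.Membership.Propositional using (_∈_)
open import Data.List.Relation.Unary.Unique.Propositional using (Unique)
open import Relation.Binary.PropositionalEquality using (_≡_; _≢_)
open import Relation.Nullary using (¬_)

record Graph : Set₁ where
  field
    V   : Set
    Adj : V → V → Set
open Graph public

data Walk (G : Graph) : V G → V G → ℕ → Set where
  here : ∀ {u} → Walk G u u zero
  step : ∀ {u v w ℓ} → Adj G u v → Walk G v w ℓ → Walk G u w (suc ℓ)

Dist : (G : Graph) → V G → V G → ℕ → Set
Dist G u v m = Walk G u v m × (∀ ℓ → ℓ < m → ¬ Walk G u v ℓ)

Resolves : (G : Graph) → V G → V G → V G → Set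
Resolves G x u v = ∀ a b → Dist G u x a → Dist G v x b → a ≢ b

IsResolving : (G : Graph) → List (V G) → Set
IsResolving G S = ∀ u v → u ≢ v → ∃[ x ] (x ∈ S × Resolves G x u v)

IsMetricDim : (G : Graph) → ℕ → Set
IsMetricDim G b =
  (∃[ S ] (Unique S × IsResolving G S × length S ≡ b)) ×
  (∀ S → Unique S → IsResolving G S → b ≤ length S)

KSubset : ℕ → ℕ → Set
KSubset n k = Σ (Subset n) (λ s → ∣ s ∣ ≡ k)

Johnson : ℕ → ℕ → Graph
Johnson n k = record
  { V = KSubset n k
  ; Adj = λ A B → ∣ proj₁ A ∩ proj₁ B ∣ ≡ k ∸ 1 }

Kneser : ℕ → ℕ → Graph
Kneser n k = record
  { V = KSubset n k
  ; Adj = λ A B → proj₁ A ∩ proj₁ B ≡ ⊥ }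

module Submission where

-- The proof rests on
-- two facts:
--   (1) d_J(A,X) = k - ∣ A ∩ X ∣: a Johnson step changes ∣ A ∩ X ∣ by at most one, and
--       exchanging an element of A ∖ X for one of X ∖ A realises this bound;
--   (2) if ∣ U ∩ X ∣ = ∣ V ∩ X ∣ then d_K(U,X) = d_K(V,X): U is carried to V by a
--       sequence of transpositions (i j), with i ∈ U ∖ V and j ∈ V ∖ U on the same side
--       of X; transpositions are automorphisms of K(n,k) and these fix X.
-- Hence a vertex x resolving u, v in K(n,k) has ∣ u ∩ x ∣ ≠ ∣ v ∩ x ∣ and so resolves
-- them in J(n,k).  Kneser distances exist because K(n,k) is connected for n > 2k (two
-- Johnson-adjacent sets have a common Kneser neighbour); constructively we only get
-- them under double negation, which suffices as the goal is a contradiction.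

open import Defs
open import Data.Nat using (ℕ; zero; suc; _+_; _*_; _∸_; _≤_; _<_; z≤n; s≤s; s≤s⁻¹; z<s)
open import Data.Nat.Properties
  using (≤-refl; ≤-trans; ≤-antisym; ≤-reflexive; ≮⇒≥; <⇒≤; +-comm; +-assoc; +-identityʳ; +-suc;
         +-cancelˡ-≡; +-cancelʳ-≡; +-cancelˡ-≤; +-mono-≤; +-monoˡ-≤; +-monoʳ-≤; suc-injective;
         ≡-irrelevant; m+n∸n≡m; m∸n+n≡m; m+[n∸m]≡n; m≤n+o⇒m∸n≤o; m+n≤o⇒m≤o;
         +-commutativeSemigroup; module ≤-Reasoning)
open import Data.Bool using (Bool; true; false; _∧_; not)
open import Data.Bool.Properties using (not-injective)
open import Data.Vec using ([]; _∷_; lookup; tabulate; updateAt)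
open import Data.Vec.Properties
  using (lookup-zipWith; lookup-map; lookup-replicate; lookup∘tabulate; tabulate∘lookup;
         tabulate-cong; lookup∘updateAt; lookup∘updateAt′)
open import Data.Fin using (Fin; zero; suc; _≟_)
open import Data.Fin.Permutation.Components using (transpose; transpose-inverse)
open import Data.Fin.Subset using (Subset; _∩_; ∁; ∣_∣; ⊥; ⊤; _⊆_)
open import Data.Fin.Subset.Properties
  using (∩-comm; ∩-idem; ∩-identityʳ; ∩-commutativeMonoid; ∣⊥∣≡0; ⊥⊆; s⊆s; out⊆; Empty-unique;
         x∈p∩q⁺; x∈p∩q⁻; x∈∁p⇒x∉p; p∩q⊆p; p∩q⊆q; ∣∁p∣≡n∸∣p∣; ∣p∩q∣≤∣p∣; p⊆q⇒∣p∣≤∣q∣)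
open import Data.Product using (Σ-syntax; _×_; _,_; proj₁; proj₂; ∃-syntax)
open import Data.List using (List)
open import Function using (_∘_; const)
open import Relation.Binary.PropositionalEquality
open import Relation.Nullary using (¬_; yes; no)
open import Relation.Nullary.Decidable using (dec-true; dec-false)
open import Algebra.Bundles using (CommutativeMonoid)
import Algebra.Properties.CommutativeSemigroup as CommutativeSemigroupProperties

map-walk : {G H : Graph} (f : V G → V H) → (∀ {u v} → Adj G u v → Adj H (f u) (f v)) →
           ∀ {u v m} → Walk G u v m → Walk H (f u) (f v) m
map-walk f hom here       = here
map-walk f hom (step e w) = step (hom e) (map-walk f hom w)

-- An endomorphism f with a homomorphic left inverse g preserves distances:
-- shorter walks between images would pull back along g.
dist-preserved : (G : Graph) (f g : V G → V G) →
  (∀ {u v} → Adj G u v → Adj G (f u) (f v)) → (∀ {u v} → Adj G u v → Adj G (g u) (g v)) →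
  (∀ u → g (f u) ≡ u) → ∀ {u x m} → Dist G u x m → Dist G (f u) (f x) m
dist-preserved G f g f-hom g-hom g∘f {u} {x} (w , shortest) =
  map-walk f f-hom w ,
  λ ℓ ℓ<m w′ → shortest ℓ ℓ<m
    (subst₂ (λ a b → Walk G a b ℓ) (g∘f u) (g∘f x) (map-walk g g-hom w′))

walk-via-two-steps : {G H : Graph} (f : V G → V H) →
  (∀ {u v} → Adj G u v → ∃[ c ] (Adj H (f u) c × Adj H c (f v))) →
  ∀ {u v m} → Walk G u v m → ∃[ ℓ ] Walk H (f u) (f v) ℓ
walk-via-two-steps f two-path here = 0 , here
walk-via-two-steps f two-path (step e w)
  with two-path e | walk-via-two-steps f two-path w
... | c , e₁ , e₂ | ℓ , w′ = suc (suc ℓ) , step e₁ (step e₂ w′)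

-- A walk yields a shortest walk; constructively only under double negation
-- (enough here, as it is used to derive a contradiction).
walk⇒¬¬dist : (G : Graph) {u v : V G} {m : ℕ} → Walk G u v m → ¬ ¬ (∃[ d ] Dist G u v d)
walk⇒¬¬dist G {u} {v} {m} w no-dist = no-walk-below (suc m) m ≤-refl w
  where
  no-walk-below : ∀ b ℓ → ℓ < b → ¬ Walk G u v ℓ
  no-walk-below (suc b) ℓ (s≤s ℓ≤b) w′ =
    no-dist (ℓ , w′ , λ ℓ′ ℓ′<ℓ → no-walk-below b ℓ′ (≤-trans ℓ′<ℓ ℓ≤b))

dist-from-bounds : (G : Graph) {u v : V G} {d m : ℕ} → Walk G u v d →
  (∀ {ℓ} → Walk G u v ℓ → d ≤ ℓ) → Dist G u v m → m ≡ d
dist-from-bounds G w lower (w′ , shortest) =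
  ≤-antisym (≮⇒≥ (λ d<m → shortest _ d<m w)) (lower w′)

module +-Rearrange = CommutativeSemigroupProperties +-commutativeSemigroup
module ∩-Rearrange {n : ℕ} =
  CommutativeSemigroupProperties (CommutativeMonoid.commutativeSemigroup (∩-commutativeMonoid n))

⟦_⟧ : Bool → ℕ
⟦ true ⟧  = 1
⟦ false ⟧ = 0

∣∷∣ : ∀ {n} b (p : Subset n) → ∣ b ∷ p ∣ ≡ ⟦ b ⟧ + ∣ p ∣
∣∷∣ true  p = refl
∣∷∣ false p = refl

lookup-∩ : ∀ {n} (p q : Subset n) i → lookup (p ∩ q) i ≡ lookup p i ∧ lookup q i
lookup-∩ p q i = lookup-zipWith _∧_ i p q

lookup-∁ : ∀ {n} (p : Subset n) i → lookup (∁ p) i ≡ not (lookup p i)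
lookup-∁ p i = lookup-map i not p

subset-ext : ∀ {n} {p q : Subset n} → (∀ i → lookup p i ≡ lookup q i) → p ≡ q
subset-ext {p = p} {q} same =
  trans (sym (tabulate∘lookup p)) (trans (tabulate-cong same) (tabulate∘lookup q))

∣p∣≡∣p∩q∣+∣p∖q∣ : ∀ {n} (p q : Subset n) → ∣ p ∣ ≡ ∣ p ∩ q ∣ + ∣ p ∩ ∁ q ∣
∣p∣≡∣p∩q∣+∣p∖q∣ []      []      = refl
∣p∣≡∣p∩q∣+∣p∖q∣ (x ∷ p) (y ∷ q) = begin
  ∣ x ∷ p ∣                                               ≡⟨ ∣∷∣ x p ⟩
  ⟦ x ⟧ + ∣ p ∣                                           ≡⟨ cong₂ _+_ (split-bit x y) (∣p∣≡∣p∩q∣+∣p∖q∣ p q) ⟩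
  (⟦ x ∧ y ⟧ + ⟦ x ∧ not y ⟧) + (∣ p ∩ q ∣ + ∣ p ∩ ∁ q ∣) ≡⟨ interchange ⟦ x ∧ y ⟧ _ _ _ ⟩
  (⟦ x ∧ y ⟧ + ∣ p ∩ q ∣) + (⟦ x ∧ not y ⟧ + ∣ p ∩ ∁ q ∣) ≡⟨ cong₂ _+_ (∣∷∣ (x ∧ y) (p ∩ q)) (∣∷∣ (x ∧ not y) (p ∩ ∁ q)) ⟨
  ∣ (x ∷ p) ∩ (y ∷ q) ∣ + ∣ (x ∷ p) ∩ ∁ (y ∷ q) ∣          ∎
  where
  open ≡-Reasoning
  open +-Rearrange using (interchange)
  split-bit : ∀ x y → ⟦ x ⟧ ≡ ⟦ x ∧ y ⟧ + ⟦ x ∧ not y ⟧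
  split-bit true  true  = refl
  split-bit true  false = refl
  split-bit false y     = refl

∣p∩x∣≤∣q∩x∣+∣p∖q∣ : ∀ {n} (p q x : Subset n) → ∣ p ∩ x ∣ ≤ ∣ q ∩ x ∣ + ∣ p ∩ ∁ q ∣
∣p∩x∣≤∣q∩x∣+∣p∖q∣ p q x = begin
  ∣ p ∩ x ∣                                 ≡⟨ ∣p∣≡∣p∩q∣+∣p∖q∣ (p ∩ x) q ⟩
  ∣ (p ∩ x) ∩ q ∣ + ∣ (p ∩ x) ∩ ∁ q ∣       ≤⟨ +-mono-≤ (p⊆q⇒∣p∣≤∣q∣ in-q∩x) (p⊆q⇒∣p∣≤∣q∣ in-p∖q) ⟩
  ∣ q ∩ x ∣ + ∣ p ∩ ∁ q ∣                   ∎
  where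
  open ≤-Reasoning
  in-q∩x : (p ∩ x) ∩ q ⊆ q ∩ x
  in-q∩x i∈ with x∈p∩q⁻ (p ∩ x) q i∈
  ... | i∈p∩x , i∈q = x∈p∩q⁺ (i∈q , proj₂ (x∈p∩q⁻ p x i∈p∩x))
  in-p∖q : (p ∩ x) ∩ ∁ q ⊆ p ∩ ∁ q
  in-p∖q i∈ with x∈p∩q⁻ (p ∩ x) (∁ q) i∈
  ... | i∈p∩x , i∈∁q = x∈p∩q⁺ (proj₁ (x∈p∩q⁻ p x i∈p∩x) , i∈∁q)

diff-balance : ∀ {n} (p q x : Subset n) → ∣ p ∩ x ∣ ≡ ∣ q ∩ x ∣ →
               ∣ (p ∩ ∁ q) ∩ x ∣ ≡ ∣ (q ∩ ∁ p) ∩ x ∣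
diff-balance p q x same = +-cancelˡ-≡ ∣ (p ∩ x) ∩ q ∣ _ _ (begin
  ∣ (p ∩ x) ∩ q ∣ + ∣ (p ∩ ∁ q) ∩ x ∣ ≡⟨ cong (λ s → ∣ (p ∩ x) ∩ q ∣ + ∣ s ∣) (xy∙z≈xz∙y p x (∁ q)) ⟨
  ∣ (p ∩ x) ∩ q ∣ + ∣ (p ∩ x) ∩ ∁ q ∣ ≡⟨ ∣p∣≡∣p∩q∣+∣p∖q∣ (p ∩ x) q ⟨
  ∣ p ∩ x ∣                           ≡⟨ same ⟩
  ∣ q ∩ x ∣                           ≡⟨ ∣p∣≡∣p∩q∣+∣p∖q∣ (q ∩ x) p ⟩
  ∣ (q ∩ x) ∩ p ∣ + ∣ (q ∩ x) ∩ ∁ p ∣ ≡⟨ cong₂ (λ s t → ∣ s ∣ + ∣ t ∣) (xy∙z≈zy∙x q x p) (xy∙z≈xz∙y q x (∁ p)) ⟩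
  ∣ (p ∩ x) ∩ q ∣ + ∣ (q ∩ ∁ p) ∩ x ∣ ∎)
  where
  open ≡-Reasoning
  open ∩-Rearrange

∣p∩⊤∣ : ∀ {n} (p : Subset n) → ∣ p ∩ ⊤ ∣ ≡ ∣ p ∣
∣p∩⊤∣ p = cong ∣_∣ (∩-identityʳ p)

∣p∖q∣≡∣q∖p∣ : ∀ {n} (p q : Subset n) → ∣ p ∣ ≡ ∣ q ∣ → ∣ p ∩ ∁ q ∣ ≡ ∣ q ∩ ∁ p ∣
∣p∖q∣≡∣q∖p∣ p q same-size = begin
  ∣ p ∩ ∁ q ∣       ≡⟨ ∣p∩⊤∣ (p ∩ ∁ q) ⟨
  ∣ (p ∩ ∁ q) ∩ ⊤ ∣ ≡⟨ diff-balance p q ⊤ (trans (∣p∩⊤∣ p) (trans same-size (sym (∣p∩⊤∣ q)))) ⟩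
  ∣ (q ∩ ∁ p) ∩ ⊤ ∣ ≡⟨ ∣p∩⊤∣ (q ∩ ∁ p) ⟩
  ∣ q ∩ ∁ p ∣       ∎
  where open ≡-Reasoning

∣p∣≡0⇒absent : ∀ {n} (p : Subset n) i → ∣ p ∣ ≡ 0 → lookup p i ≡ false
∣p∣≡0⇒absent (true  ∷ p) i       ()
∣p∣≡0⇒absent (false ∷ p) zero    _     = refl
∣p∣≡0⇒absent (false ∷ p) (suc i) empty = ∣p∣≡0⇒absent p i empty

nonempty⇒member : ∀ {n} (p : Subset n) → 0 < ∣ p ∣ → ∃[ i ] lookup p i ≡ true
nonempty⇒member (true  ∷ p) _        = zero , refl
nonempty⇒member (false ∷ p) nonempty =
  let i , i∈p = nonempty⇒member p nonempty in suc i , i∈p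

∣p∖q∣≡0⇒p≡q : ∀ {n} (p q : Subset n) → ∣ p ∣ ≡ ∣ q ∣ → ∣ p ∩ ∁ q ∣ ≡ 0 → p ≡ q
∣p∖q∣≡0⇒p≡q p q same-size p∖q-empty = subset-ext λ i →
  same-bit (lookup p i) (lookup q i) (absent-from p q i p∖q-empty) (absent-from q p i q∖p-empty)
  where
  q∖p-empty : ∣ q ∩ ∁ p ∣ ≡ 0
  q∖p-empty = trans (sym (∣p∖q∣≡∣q∖p∣ p q same-size)) p∖q-empty
  absent-from : ∀ a b i → ∣ a ∩ ∁ b ∣ ≡ 0 → lookup a i ∧ not (lookup b i) ≡ false
  absent-from a b i empty =
    trans (sym (trans (lookup-∩ a (∁ b) i) (cong (lookup a i ∧_) (lookup-∁ b i))))
          (∣p∣≡0⇒absent (a ∩ ∁ b) i empty)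
  same-bit : ∀ x y → x ∧ not y ≡ false → y ∧ not x ≡ false → x ≡ y
  same-bit true  true  _ _ = refl
  same-bit false false _ _ = refl
  same-bit true  false () _
  same-bit false true  _ ()

count-one-point : ∀ {n} (p q : Subset n) i → (∀ k → k ≢ i → lookup p k ≡ lookup q k) →
                  ∣ p ∣ + ⟦ lookup q i ⟧ ≡ ∣ q ∣ + ⟦ lookup p i ⟧
count-one-point (x ∷ p) (y ∷ q) zero agree = begin
  ∣ x ∷ p ∣ + ⟦ y ⟧       ≡⟨ cong (_+ ⟦ y ⟧) (∣∷∣ x p) ⟩
  (⟦ x ⟧ + ∣ p ∣) + ⟦ y ⟧ ≡⟨ xy∙z≈zy∙x ⟦ x ⟧ ∣ p ∣ ⟦ y ⟧ ⟩
  (⟦ y ⟧ + ∣ p ∣) + ⟦ x ⟧ ≡⟨ cong (λ s → (⟦ y ⟧ + ∣ s ∣) + ⟦ x ⟧) p≡q ⟩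
  (⟦ y ⟧ + ∣ q ∣) + ⟦ x ⟧ ≡⟨ cong (_+ ⟦ x ⟧) (∣∷∣ y q) ⟨
  ∣ y ∷ q ∣ + ⟦ x ⟧       ∎
  where
  open ≡-Reasoning
  open +-Rearrange
  p≡q : p ≡ q
  p≡q = subset-ext (λ k → agree (suc k) λ ())
count-one-point (x ∷ p) (y ∷ q) (suc i) agree with agree zero (λ ())
... | refl = begin
  ∣ x ∷ p ∣ + ⟦ lookup q i ⟧       ≡⟨ cong (_+ ⟦ lookup q i ⟧) (∣∷∣ x p) ⟩
  (⟦ x ⟧ + ∣ p ∣) + ⟦ lookup q i ⟧ ≡⟨ +-assoc ⟦ x ⟧ _ _ ⟩
  ⟦ x ⟧ + (∣ p ∣ + ⟦ lookup q i ⟧) ≡⟨ cong (⟦ x ⟧ +_) (count-one-point p q i agree-tail) ⟩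
  ⟦ x ⟧ + (∣ q ∣ + ⟦ lookup p i ⟧) ≡⟨ +-assoc ⟦ x ⟧ _ _ ⟨
  (⟦ x ⟧ + ∣ q ∣) + ⟦ lookup p i ⟧ ≡⟨ cong (_+ ⟦ lookup p i ⟧) (∣∷∣ x q) ⟨
  ∣ x ∷ q ∣ + ⟦ lookup p i ⟧       ∎
  where
  open ≡-Reasoning
  agree-tail : ∀ k → k ≢ i → lookup p k ≡ lookup q k
  agree-tail k k≢i = agree (suc k) λ { refl → k≢i refl }

count-two-points : ∀ {n} (p q : Subset n) {i j} → i ≢ j →
  (∀ k → k ≢ i → k ≢ j → lookup p k ≡ lookup q k) →
  ∣ p ∣ + (⟦ lookup q i ⟧ + ⟦ lookup q j ⟧) ≡ ∣ q ∣ + (⟦ lookup p i ⟧ + ⟦ lookup p j ⟧)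
count-two-points p q {i} {j} i≢j agree = begin
  ∣ p ∣ + (⟦ lookup q i ⟧ + ⟦ lookup q j ⟧) ≡⟨ x∙yz≈xz∙y ∣ p ∣ _ _ ⟩
  (∣ p ∣ + ⟦ lookup q j ⟧) + ⟦ lookup q i ⟧ ≡⟨ cong (λ b → (∣ p ∣ + ⟦ b ⟧) + ⟦ lookup q i ⟧) w-j ⟨
  (∣ p ∣ + ⟦ lookup w j ⟧) + ⟦ lookup q i ⟧ ≡⟨ cong (_+ ⟦ lookup q i ⟧) (count-one-point p w j p≈w) ⟩
  (∣ w ∣ + ⟦ lookup p j ⟧) + ⟦ lookup q i ⟧ ≡⟨ xy∙z≈xz∙y ∣ w ∣ _ _ ⟩
  (∣ w ∣ + ⟦ lookup q i ⟧) + ⟦ lookup p j ⟧ ≡⟨ cong (_+ ⟦ lookup p j ⟧) (count-one-point w q i w≈q) ⟩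
  (∣ q ∣ + ⟦ lookup w i ⟧) + ⟦ lookup p j ⟧ ≡⟨ cong (λ b → (∣ q ∣ + ⟦ b ⟧) + ⟦ lookup p j ⟧) w-i ⟩
  (∣ q ∣ + ⟦ lookup p i ⟧) + ⟦ lookup p j ⟧ ≡⟨ +-assoc ∣ q ∣ _ _ ⟩
  ∣ q ∣ + (⟦ lookup p i ⟧ + ⟦ lookup p j ⟧) ∎
  where
  open ≡-Reasoning
  open +-Rearrange
  w : Subset _
  w = updateAt q i (const (lookup p i))
  w-i : lookup w i ≡ lookup p i
  w-i = lookup∘updateAt i q
  w-j : lookup w j ≡ lookup q j
  w-j = lookup∘updateAt′ j i (i≢j ∘ sym) q
  w≈q : ∀ k → k ≢ i → lookup w k ≡ lookup q k
  w≈q k k≢i = lookup∘updateAt′ k i k≢i q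
  p≈w : ∀ k → k ≢ j → lookup p k ≡ lookup w k
  p≈w k k≢j with k ≟ i
  ... | yes refl = sym w-i
  ... | no k≢i   = trans (agree k k≢i k≢j) (sym (w≈q k k≢i))

choose : ∀ {n} k (w : Subset n) → k ≤ ∣ w ∣ → ∃[ c ] (∣ c ∣ ≡ k × c ⊆ w)
choose {n} zero w           _           = ⊥ , ∣⊥∣≡0 n , ⊥⊆
choose (suc k) (true ∷ w)  (s≤s k≤∣w∣) =
  let c , ∣c∣≡k , c⊆w = choose k w k≤∣w∣ in true ∷ c , cong suc ∣c∣≡k , s⊆s c⊆w
choose (suc k) (false ∷ w) k<∣w∣       =
  let c , ∣c∣≡k , c⊆w = choose (suc k) w k<∣w∣ in false ∷ c , ∣c∣≡k , out⊆ c⊆w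

⊆∁⇒disjoint : ∀ {n} (p q : Subset n) → p ⊆ ∁ q → q ∩ p ≡ ⊥
⊆∁⇒disjoint p q p⊆∁q = Empty-unique λ (i , i∈q∩p) →
  let i∈q , i∈p = x∈p∩q⁻ q p i∈q∩p in x∈∁p⇒x∉p (p⊆∁q i∈p) i∈q

transpose-i : ∀ {n} (i j : Fin n) → transpose i j i ≡ j
transpose-i i j rewrite dec-true (i ≟ i) refl = refl

transpose-j : ∀ {n} (i j : Fin n) → transpose i j j ≡ i
transpose-j i j with j ≟ i
... | yes j≡i = j≡i
... | no  _   rewrite dec-true (j ≟ j) refl = refl

transpose-other : ∀ {n} {i j k : Fin n} → k ≢ i → k ≢ j → transpose i j k ≡ k
transpose-other {i = i} {j} {k} k≢i k≢j
  rewrite dec-false (k ≟ i) k≢i | dec-false (k ≟ j) k≢j = refl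

swap : ∀ {n} → Fin n → Fin n → Subset n → Subset n
swap i j s = tabulate (lookup s ∘ transpose i j)

lookup-swap : ∀ {n} (i j : Fin n) s k → lookup (swap i j s) k ≡ lookup s (transpose i j k)
lookup-swap i j s = lookup∘tabulate (lookup s ∘ transpose i j)

lookup-swap-i : ∀ {n} (i j : Fin n) s → lookup (swap i j s) i ≡ lookup s j
lookup-swap-i i j s = trans (lookup-swap i j s i) (cong (lookup s) (transpose-i i j))

lookup-swap-j : ∀ {n} (i j : Fin n) s → lookup (swap i j s) j ≡ lookup s i
lookup-swap-j i j s = trans (lookup-swap i j s j) (cong (lookup s) (transpose-j i j))

lookup-swap-other : ∀ {n} {i j k : Fin n} s → k ≢ i → k ≢ j → lookup (swap i j s) k ≡ lookup s k
lookup-swap-other {i = i} {j} {k} s k≢i k≢j =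
  trans (lookup-swap i j s k) (cong (lookup s) (transpose-other k≢i k≢j))

swap-∩ : ∀ {n} (i j : Fin n) p q → swap i j (p ∩ q) ≡ swap i j p ∩ swap i j q
swap-∩ i j p q = subset-ext λ k → begin
  lookup (swap i j (p ∩ q)) k                       ≡⟨ lookup-swap i j (p ∩ q) k ⟩
  lookup (p ∩ q) (transpose i j k)                  ≡⟨ lookup-∩ p q _ ⟩
  lookup p (transpose i j k) ∧ lookup q (transpose i j k)
                                                    ≡⟨ cong₂ _∧_ (lookup-swap i j p k) (lookup-swap i j q k) ⟨
  lookup (swap i j p) k ∧ lookup (swap i j q) k     ≡⟨ lookup-∩ (swap i j p) (swap i j q) k ⟨
  lookup (swap i j p ∩ swap i j q) k                ∎
  where open ≡-Reasoning

swap-⊥ : ∀ {n} (i j : Fin n) → swap i j ⊥ ≡ ⊥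
swap-⊥ {n} i j = subset-ext λ k →
  trans (lookup-swap i j ⊥ k) (trans (lookup-replicate {n = n} (transpose i j k) false) (sym (lookup-replicate k false)))

swap-inverse : ∀ {n} (i j : Fin n) s → swap j i (swap i j s) ≡ s
swap-inverse i j s = subset-ext λ k →
  trans (lookup-swap j i (swap i j s) k)
        (trans (lookup-swap i j s (transpose j i k)) (cong (lookup s) (transpose-inverse i j)))

swap-fix : ∀ {n} (i j : Fin n) s → lookup s i ≡ lookup s j → swap i j s ≡ s
swap-fix i j s sᵢ≡sⱼ = subset-ext fixed
  where
  fixed : ∀ k → lookup (swap i j s) k ≡ lookup s k
  fixed k with k ≟ i | k ≟ j
  ... | yes refl | _        = trans (lookup-swap-i k j s) (sym sᵢ≡sⱼ)
  ... | no _     | yes refl = trans (lookup-swap-j i k s) sᵢ≡sⱼ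
  ... | no k≢i   | no k≢j   = lookup-swap-other s k≢i k≢j

∣swap∣ : ∀ {n} (i j : Fin n) s → ∣ swap i j s ∣ ≡ ∣ s ∣
∣swap∣ i j s with i ≟ j
... | yes refl = cong ∣_∣ (swap-fix i i s refl)
... | no  i≢j  = +-cancelʳ-≡ (⟦ lookup s i ⟧ + ⟦ lookup s j ⟧) _ _ (begin
  ∣ swap i j s ∣ + (⟦ lookup s i ⟧ + ⟦ lookup s j ⟧)
    ≡⟨ count-two-points (swap i j s) s i≢j (λ k → lookup-swap-other s) ⟩
  ∣ s ∣ + (⟦ lookup (swap i j s) i ⟧ + ⟦ lookup (swap i j s) j ⟧)
    ≡⟨ cong₂ (λ b c → ∣ s ∣ + (⟦ b ⟧ + ⟦ c ⟧)) (lookup-swap-i i j s) (lookup-swap-j i j s) ⟩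
  ∣ s ∣ + (⟦ lookup s j ⟧ + ⟦ lookup s i ⟧)
    ≡⟨ cong (∣ s ∣ +_) (+-comm ⟦ lookup s j ⟧ _) ⟩
  ∣ s ∣ + (⟦ lookup s i ⟧ + ⟦ lookup s j ⟧) ∎)
  where open ≡-Reasoning

exchange-count : ∀ {n} (a y : Subset n) {i j} → lookup a i ≡ true → lookup a j ≡ false →
  ∣ swap i j a ∩ y ∣ + ⟦ lookup y i ⟧ ≡ ∣ a ∩ y ∣ + ⟦ lookup y j ⟧
exchange-count a y {i} {j} aᵢ aⱼ = begin
  ∣ u ∣ + ⟦ lookup y i ⟧                    ≡⟨ cong (∣ u ∣ +_) (+-identityʳ ⟦ lookup y i ⟧) ⟨
  ∣ u ∣ + (⟦ lookup y i ⟧ + ⟦ false ⟧)      ≡⟨ cong₂ (λ b c → ∣ u ∣ + (⟦ b ⟧ + ⟦ c ⟧)) vᵢ vⱼ ⟨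
  ∣ u ∣ + (⟦ lookup v i ⟧ + ⟦ lookup v j ⟧) ≡⟨ count-two-points u v i≢j agree ⟩
  ∣ v ∣ + (⟦ lookup u i ⟧ + ⟦ lookup u j ⟧) ≡⟨ cong₂ (λ b c → ∣ v ∣ + (⟦ b ⟧ + ⟦ c ⟧)) uᵢ uⱼ ⟩
  ∣ v ∣ + ⟦ lookup y j ⟧                    ∎
  where
  open ≡-Reasoning
  u v : Subset _
  u = swap i j a ∩ y
  v = a ∩ y
  i≢j : i ≢ j
  i≢j i≡j with trans (sym aᵢ) (trans (cong (lookup a) i≡j) aⱼ)
  ... | ()
  agree : ∀ k → k ≢ i → k ≢ j → lookup u k ≡ lookup v k
  agree k k≢i k≢j = begin
    lookup u k                        ≡⟨ lookup-∩ (swap i j a) y k ⟩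
    lookup (swap i j a) k ∧ lookup y k ≡⟨ cong (_∧ lookup y k) (lookup-swap-other a k≢i k≢j) ⟩
    lookup a k ∧ lookup y k           ≡⟨ lookup-∩ a y k ⟨
    lookup v k                        ∎
  vᵢ : lookup v i ≡ lookup y i
  vᵢ = trans (lookup-∩ a y i) (cong (_∧ lookup y i) aᵢ)
  vⱼ : lookup v j ≡ false
  vⱼ = trans (lookup-∩ a y j) (cong (_∧ lookup y j) aⱼ)
  uᵢ : lookup u i ≡ false
  uᵢ = trans (lookup-∩ (swap i j a) y i) (cong (_∧ lookup y i) (trans (lookup-swap-i i j a) aⱼ))
  uⱼ : lookup u j ≡ lookup y j
  uⱼ = trans (lookup-∩ (swap i j a) y j) (cong (_∧ lookup y j) (trans (lookup-swap-j i j a) aᵢ))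

-- An element i of p ∖ q and an element j of q ∖ p; swap i j moves p one step towards q.
record ExchangePair {n} (p q : Subset n) : Set where
  field
    i j : Fin n
    i∈p : lookup p i ≡ true
    i∉q : lookup q i ≡ false
    j∉p : lookup p j ≡ false
    j∈q : lookup q j ≡ true

member-of-diff : ∀ {n} (p q y : Subset n) i → lookup ((p ∩ ∁ q) ∩ y) i ≡ true →
                 lookup p i ≡ true × lookup q i ≡ false × lookup y i ≡ true
member-of-diff p q y i i∈ = unfold (lookup p i) (lookup q i) (lookup y i) (begin
  (lookup p i ∧ not (lookup q i)) ∧ lookup y i ≡⟨ cong (_∧ lookup y i) (cong (lookup p i ∧_) (lookup-∁ q i)) ⟨
  (lookup p i ∧ lookup (∁ q) i) ∧ lookup y i   ≡⟨ cong (_∧ lookup y i) (lookup-∩ p (∁ q) i) ⟨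
  lookup (p ∩ ∁ q) i ∧ lookup y i              ≡⟨ lookup-∩ (p ∩ ∁ q) y i ⟨
  lookup ((p ∩ ∁ q) ∩ y) i                     ≡⟨ i∈ ⟩
  true                                         ∎)
  where
  open ≡-Reasoning
  unfold : ∀ a b c → (a ∧ not b) ∧ c ≡ true → a ≡ true × b ≡ false × c ≡ true
  unfold true false true _ = refl , refl , refl

exchange-pair-within : ∀ {n} (p q y : Subset n) → ∣ p ∩ y ∣ ≡ ∣ q ∩ y ∣ → 0 < ∣ (p ∩ ∁ q) ∩ y ∣ →
  Σ[ e ∈ ExchangePair p q ] (lookup y (ExchangePair.i e) ≡ true × lookup y (ExchangePair.j e) ≡ true)
exchange-pair-within p q y same-meet nonempty
  with nonempty⇒member ((p ∩ ∁ q) ∩ y) nonempty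
     | nonempty⇒member ((q ∩ ∁ p) ∩ y) (subst (0 <_) (diff-balance p q y same-meet) nonempty)
... | i , i∈ | j , j∈
  with member-of-diff p q y i i∈ | member-of-diff q p y j j∈
... | i∈p , i∉q , i∈y | j∈q , j∉p , j∈y =
  record { i = i ; j = j ; i∈p = i∈p ; i∉q = i∉q ; j∉p = j∉p ; j∈q = j∈q } , i∈y , j∈y

exchange-pair : ∀ {n} (p q : Subset n) → ∣ p ∣ ≡ ∣ q ∣ → 0 < ∣ p ∩ ∁ q ∣ → ExchangePair p q
exchange-pair p q same-size nonempty =
  proj₁ (exchange-pair-within p q ⊤ (trans (∣p∩⊤∣ p) (trans same-size (sym (∣p∩⊤∣ q))))
                                    (subst (0 <_) (sym (∣p∩⊤∣ (p ∩ ∁ q))) nonempty))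

balanced-exchange-pair : ∀ {n} (p q x : Subset n) → ∣ p ∣ ≡ ∣ q ∣ → ∣ p ∩ x ∣ ≡ ∣ q ∩ x ∣ →
  0 < ∣ p ∩ ∁ q ∣ → Σ[ e ∈ ExchangePair p q ] lookup x (ExchangePair.i e) ≡ lookup x (ExchangePair.j e)
balanced-exchange-pair p q x same-size same-meet nonempty with ∣ (p ∩ ∁ q) ∩ x ∣ in meets-x
... | suc _ =
  let e , i∈x , j∈x = exchange-pair-within p q x same-meet (subst (0 <_) (sym meets-x) z<s)
  in e , trans i∈x (sym j∈x)
... | zero =
  let e , i∈∁x , j∈∁x = exchange-pair-within p q (∁ x) same-meet-outside nonempty-outside
  in e , not-injective (trans (sym (lookup-∁ x _)) (trans i∈∁x (trans (sym j∈∁x) (lookup-∁ x _))))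
  where
  open ≡-Reasoning
  same-meet-outside : ∣ p ∩ ∁ x ∣ ≡ ∣ q ∩ ∁ x ∣
  same-meet-outside = +-cancelˡ-≡ ∣ p ∩ x ∣ _ _ (begin
    ∣ p ∩ x ∣ + ∣ p ∩ ∁ x ∣ ≡⟨ ∣p∣≡∣p∩q∣+∣p∖q∣ p x ⟨
    ∣ p ∣                   ≡⟨ same-size ⟩
    ∣ q ∣                   ≡⟨ ∣p∣≡∣p∩q∣+∣p∖q∣ q x ⟩
    ∣ q ∩ x ∣ + ∣ q ∩ ∁ x ∣ ≡⟨ cong (_+ ∣ q ∩ ∁ x ∣) same-meet ⟨
    ∣ p ∩ x ∣ + ∣ q ∩ ∁ x ∣ ∎)
  nonempty-outside : 0 < ∣ (p ∩ ∁ q) ∩ ∁ x ∣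
  nonempty-outside =
    subst (0 <_) (trans (∣p∣≡∣p∩q∣+∣p∖q∣ (p ∩ ∁ q) x) (cong (_+ ∣ (p ∩ ∁ q) ∩ ∁ x ∣) meets-x)) nonempty

module _ {n k : ℕ} where

  ksubset-≡ : {A B : KSubset n k} → proj₁ A ≡ proj₁ B → A ≡ B
  ksubset-≡ {s , ∣s∣≡k} {.s , ∣s∣≡k′} refl = cong (s ,_) (≡-irrelevant ∣s∣≡k ∣s∣≡k′)

  swapₖ : Fin n → Fin n → KSubset n k → KSubset n k
  swapₖ i j A = swap i j (proj₁ A) , trans (∣swap∣ i j (proj₁ A)) (proj₂ A)

  ∣A∣≡∣B∣ : (A B : KSubset n k) → ∣ proj₁ A ∣ ≡ ∣ proj₁ B ∣
  ∣A∣≡∣B∣ A B = trans (proj₂ A) (sym (proj₂ B))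

  ∣A∩X∣≤k : (A X : KSubset n k) → ∣ proj₁ A ∩ proj₁ X ∣ ≤ k
  ∣A∩X∣≤k A X = ≤-trans (∣p∩q∣≤∣p∣ (proj₁ A) (proj₁ X)) (≤-reflexive (proj₂ A))

  johnson-step : (A B : KSubset n k) → Adj (Johnson n k) A B → ∣ proj₁ B ∩ ∁ (proj₁ A) ∣ ≤ 1
  johnson-step (a , ∣a∣≡k) (b , ∣b∣≡k) ∣a∩b∣≡k-1 = at-most-one k ∣ b ∩ ∁ a ∣ (begin
    k                         ≡⟨ ∣b∣≡k ⟨
    ∣ b ∣                     ≡⟨ ∣p∣≡∣p∩q∣+∣p∖q∣ b a ⟩
    ∣ b ∩ a ∣ + ∣ b ∩ ∁ a ∣   ≡⟨ cong (λ s → ∣ s ∣ + ∣ b ∩ ∁ a ∣) (∩-comm b a) ⟩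
    ∣ a ∩ b ∣ + ∣ b ∩ ∁ a ∣   ≡⟨ cong (_+ ∣ b ∩ ∁ a ∣) ∣a∩b∣≡k-1 ⟩
    (k ∸ 1) + ∣ b ∩ ∁ a ∣     ∎)
    where
    open ≡-Reasoning
    at-most-one : ∀ m t → m ≡ (m ∸ 1) + t → t ≤ 1
    at-most-one zero    t 0≡t = ≤-trans (≤-reflexive (sym 0≡t)) z≤n
    at-most-one (suc m) t eq  = ≤-reflexive (+-cancelˡ-≡ m t 1 (trans (sym eq) (+-comm 1 m)))

  johnson-lower : {A X : KSubset n k} {ℓ : ℕ} → Walk (Johnson n k) A X ℓ →
                  k ≤ ∣ proj₁ A ∩ proj₁ X ∣ + ℓ
  johnson-lower {A} here = ≤-reflexive (begin
    k                         ≡⟨ proj₂ A ⟨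
    ∣ proj₁ A ∣               ≡⟨ cong ∣_∣ (∩-idem (proj₁ A)) ⟨
    ∣ proj₁ A ∩ proj₁ A ∣     ≡⟨ +-identityʳ _ ⟨
    ∣ proj₁ A ∩ proj₁ A ∣ + 0 ∎)
    where open ≡-Reasoning
  johnson-lower {A} {X} {suc ℓ} (step {v = B} adj w) = begin
    k                                     ≤⟨ johnson-lower w ⟩
    ∣ proj₁ B ∩ proj₁ X ∣ + ℓ             ≤⟨ +-monoˡ-≤ ℓ (∣p∩x∣≤∣q∩x∣+∣p∖q∣ (proj₁ B) (proj₁ A) (proj₁ X)) ⟩
    (∣ proj₁ A ∩ proj₁ X ∣ + ∣ proj₁ B ∩ ∁ (proj₁ A) ∣) + ℓ
                                          ≤⟨ +-monoˡ-≤ ℓ (+-monoʳ-≤ ∣ proj₁ A ∩ proj₁ X ∣ (johnson-step A B adj)) ⟩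
    (∣ proj₁ A ∩ proj₁ X ∣ + 1) + ℓ       ≡⟨ +-assoc ∣ proj₁ A ∩ proj₁ X ∣ 1 ℓ ⟩
    ∣ proj₁ A ∩ proj₁ X ∣ + suc ℓ         ∎
    where open ≤-Reasoning

  -- Exchanging, one at a time, elements of A ∖ X for elements of X ∖ A walks from
  -- A to X in k - ∣ A ∩ X ∣ Johnson steps.
  johnson-walk : ∀ d (A X : KSubset n k) → d + ∣ proj₁ A ∩ proj₁ X ∣ ≡ k → Walk (Johnson n k) A X d
  johnson-walk zero A X ∣a∩x∣≡k = subst (λ Y → Walk (Johnson n k) A Y 0) (ksubset-≡ a≡x) here
    where
    a = proj₁ A
    x = proj₁ X
    a∖x-empty : ∣ a ∩ ∁ x ∣ ≡ 0
    a∖x-empty = +-cancelˡ-≡ ∣ a ∩ x ∣ _ 0 (begin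
      ∣ a ∩ x ∣ + ∣ a ∩ ∁ x ∣ ≡⟨ ∣p∣≡∣p∩q∣+∣p∖q∣ a x ⟨
      ∣ a ∣                   ≡⟨ trans (proj₂ A) (sym ∣a∩x∣≡k) ⟩
      ∣ a ∩ x ∣               ≡⟨ +-identityʳ _ ⟨
      ∣ a ∩ x ∣ + 0           ∎)
      where open ≡-Reasoning
    a≡x : a ≡ x
    a≡x = ∣p∖q∣≡0⇒p≡q a x (∣A∣≡∣B∣ A X) a∖x-empty
  johnson-walk (suc d) A X d+1+∣a∩x∣≡k = step adjacent (johnson-walk d A′ X closer)
    where
    open ≡-Reasoning
    a = proj₁ A
    x = proj₁ X
    ∣a∖x∣≡1+d : ∣ a ∩ ∁ x ∣ ≡ suc d
    ∣a∖x∣≡1+d = +-cancelˡ-≡ ∣ a ∩ x ∣ _ _ (begin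
      ∣ a ∩ x ∣ + ∣ a ∩ ∁ x ∣ ≡⟨ ∣p∣≡∣p∩q∣+∣p∖q∣ a x ⟨
      ∣ a ∣                   ≡⟨ trans (proj₂ A) (sym d+1+∣a∩x∣≡k) ⟩
      suc d + ∣ a ∩ x ∣       ≡⟨ +-comm (suc d) _ ⟩
      ∣ a ∩ x ∣ + suc d       ∎)
    e : ExchangePair a x
    e = exchange-pair a x (∣A∣≡∣B∣ A X) (subst (0 <_) (sym ∣a∖x∣≡1+d) z<s)
    open ExchangePair e
    A′ = swapₖ i j A
    a′ = proj₁ A′
    adjacent : ∣ a ∩ a′ ∣ ≡ k ∸ 1
    adjacent = begin
      ∣ a ∩ a′ ∣             ≡⟨ cong ∣_∣ (∩-comm a a′) ⟩
      ∣ a′ ∩ a ∣             ≡⟨ m+n∸n≡m ∣ a′ ∩ a ∣ 1 ⟨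
      ∣ a′ ∩ a ∣ + 1 ∸ 1     ≡⟨ cong (λ b → ∣ a′ ∩ a ∣ + ⟦ b ⟧ ∸ 1) i∈p ⟨
      ∣ a′ ∩ a ∣ + ⟦ lookup a i ⟧ ∸ 1
                             ≡⟨ cong (_∸ 1) (exchange-count a a i∈p j∉p) ⟩
      ∣ a ∩ a ∣ + ⟦ lookup a j ⟧ ∸ 1
                             ≡⟨ cong₂ (λ s b → ∣ s ∣ + ⟦ b ⟧ ∸ 1) (∩-idem a) j∉p ⟩
      ∣ a ∣ + 0 ∸ 1          ≡⟨ cong (λ t → t + 0 ∸ 1) (proj₂ A) ⟩
      k + 0 ∸ 1              ≡⟨ cong (_∸ 1) (+-identityʳ k) ⟩
      k ∸ 1                  ∎
    closer : d + ∣ a′ ∩ x ∣ ≡ k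
    closer = begin
      d + ∣ a′ ∩ x ∣         ≡⟨ cong (d +_) (+-identityʳ _) ⟨
      d + (∣ a′ ∩ x ∣ + 0)   ≡⟨ cong (λ b → d + (∣ a′ ∩ x ∣ + ⟦ b ⟧)) i∉q ⟨
      d + (∣ a′ ∩ x ∣ + ⟦ lookup x i ⟧)
                             ≡⟨ cong (d +_) (exchange-count a x i∈p j∉p) ⟩
      d + (∣ a ∩ x ∣ + ⟦ lookup x j ⟧)
                             ≡⟨ cong (λ b → d + (∣ a ∩ x ∣ + ⟦ b ⟧)) j∈q ⟩
      d + (∣ a ∩ x ∣ + 1)    ≡⟨ cong (d +_) (+-comm _ 1) ⟩
      d + suc ∣ a ∩ x ∣      ≡⟨ +-suc d _ ⟩
      suc d + ∣ a ∩ x ∣      ≡⟨ d+1+∣a∩x∣≡k ⟩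
      k                      ∎

  johnson-connected : (A X : KSubset n k) → Walk (Johnson n k) A X (k ∸ ∣ proj₁ A ∩ proj₁ X ∣)
  johnson-connected A X = johnson-walk _ A X (m∸n+n≡m (∣A∩X∣≤k A X))

  johnson-dist : {A X : KSubset n k} {m : ℕ} → Dist (Johnson n k) A X m → ∣ proj₁ A ∩ proj₁ X ∣ + m ≡ k
  johnson-dist {A} {X} dist =
    trans (cong (∣ proj₁ A ∩ proj₁ X ∣ +_) (dist-from-bounds (Johnson n k) (johnson-connected A X) lower dist))
          (m+[n∸m]≡n (∣A∩X∣≤k A X))
    where
    lower : ∀ {ℓ} → Walk (Johnson n k) A X ℓ → k ∸ ∣ proj₁ A ∩ proj₁ X ∣ ≤ ℓ
    lower w = m≤n+o⇒m∸n≤o k _ (johnson-lower w)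

  johnson-same-meet : {U V X : KSubset n k} {m : ℕ} → Dist (Johnson n k) U X m → Dist (Johnson n k) V X m →
                      ∣ proj₁ U ∩ proj₁ X ∣ ≡ ∣ proj₁ V ∩ proj₁ X ∣
  johnson-same-meet {m = m} dᵤ dᵥ = +-cancelʳ-≡ m _ _ (trans (johnson-dist dᵤ) (sym (johnson-dist dᵥ)))

  -- For n > 2k, Johnson-adjacent sets have a common Kneser neighbour: the
  -- complement of A ∪ B still has k elements.
  kneser-common-neighbour : 2 * k < n → {A B : KSubset n k} → Adj (Johnson n k) A B →
                            ∃[ C ] (Adj (Kneser n k) A C × Adj (Kneser n k) C B)
  kneser-common-neighbour 2k<n {A} {B} adj =
    (c , ∣c∣≡k) ,
    ⊆∁⇒disjoint c a (λ i∈c → p∩q⊆p (∁ a) (∁ b) (c⊆w i∈c)) ,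
    trans (∩-comm c b) (⊆∁⇒disjoint c b (λ i∈c → p∩q⊆q (∁ a) (∁ b) (c⊆w i∈c)))
    where
    a = proj₁ A
    b = proj₁ B
    w = ∁ a ∩ ∁ b
    k≤n : k ≤ n
    k≤n = m+n≤o⇒m≤o k (<⇒≤ 2k<n)
    room : k + suc k ≤ k + suc ∣ w ∣
    room = begin
      k + suc k               ≡⟨ +-suc k k ⟩
      suc (k + k)             ≡⟨ cong (λ t → suc (k + t)) (+-identityʳ k) ⟨
      suc (2 * k)             ≤⟨ 2k<n ⟩
      n                       ≡⟨ m+[n∸m]≡n k≤n ⟨
      k + (n ∸ k)             ≡⟨ cong (λ t → k + (n ∸ t)) (proj₂ A) ⟨
      k + (n ∸ ∣ a ∣)         ≡⟨ cong (k +_) (∣∁p∣≡n∸∣p∣ a) ⟨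
      k + ∣ ∁ a ∣             ≡⟨ cong (k +_) (∣p∣≡∣p∩q∣+∣p∖q∣ (∁ a) b) ⟩
      k + (∣ ∁ a ∩ b ∣ + ∣ w ∣) ≡⟨ cong (λ s → k + (∣ s ∣ + ∣ w ∣)) (∩-comm (∁ a) b) ⟩
      k + (∣ b ∩ ∁ a ∣ + ∣ w ∣) ≤⟨ +-monoʳ-≤ k (+-monoˡ-≤ ∣ w ∣ (johnson-step A B adj)) ⟩
      k + suc ∣ w ∣           ∎
      where open ≤-Reasoning
    chosen = choose k w (s≤s⁻¹ (+-cancelˡ-≤ k _ _ room))
    c = proj₁ chosen
    ∣c∣≡k = proj₁ (proj₂ chosen)
    c⊆w = proj₂ (proj₂ chosen)

  kneser-connected : 2 * k < n → (A B : KSubset n k) → ∃[ ℓ ] Walk (Kneser n k) A B ℓ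
  kneser-connected 2k<n A B =
    walk-via-two-steps (λ C → C) (λ {A} {B} → kneser-common-neighbour 2k<n {A} {B}) (johnson-connected A B)

  -- Transpositions are automorphisms of K(n,k), so one fixing X preserves distances to X.
  kneser-swap-dist : (i j : Fin n) {U X : KSubset n k} {m : ℕ} →
    lookup (proj₁ X) i ≡ lookup (proj₁ X) j → Dist (Kneser n k) U X m → Dist (Kneser n k) (swapₖ i j U) X m
  kneser-swap-dist i j {U} {X} {m} X-fixed dist =
    subst (λ Y → Dist (Kneser n k) (swapₖ i j U) Y m) (ksubset-≡ (swap-fix i j (proj₁ X) X-fixed))
      (dist-preserved (Kneser n k) (swapₖ i j) (swapₖ j i) (λ {A} {B} → automorphism i j {A} {B}) (λ {A} {B} → automorphism j i {A} {B})
                      (λ A → ksubset-≡ (swap-inverse i j (proj₁ A))) dist)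
    where
    automorphism : ∀ i j {A B} → Adj (Kneser n k) A B → Adj (Kneser n k) (swapₖ i j A) (swapₖ i j B)
    automorphism i j {A} {B} disjoint =
      trans (sym (swap-∩ i j (proj₁ A) (proj₁ B))) (trans (cong (swap i j) disjoint) (swap-⊥ i j))

  -- Transform U into V by exchanges that do not separate X (induction on d = ∣ U ∖ V ∣), each an
  -- automorphism fixing X.
  kneser-equidistant-by : ∀ d (U V X : KSubset n k) {m : ℕ} → ∣ proj₁ U ∩ ∁ (proj₁ V) ∣ ≡ d →
    ∣ proj₁ U ∩ proj₁ X ∣ ≡ ∣ proj₁ V ∩ proj₁ X ∣ → Dist (Kneser n k) U X m → Dist (Kneser n k) V X m
  kneser-equidistant-by zero U V X {m} u∖v-empty _ dist =
    subst (λ W → Dist (Kneser n k) W X m)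
          (ksubset-≡ (∣p∖q∣≡0⇒p≡q (proj₁ U) (proj₁ V) (∣A∣≡∣B∣ U V) u∖v-empty)) dist
  kneser-equidistant-by (suc d) U V X ∣u∖v∣≡1+d same-meet dist =
    kneser-equidistant-by d (swapₖ i j U) V X closer same-meet′ (kneser-swap-dist i j X-fixed dist)
    where
    open ≡-Reasoning
    u = proj₁ U
    v = proj₁ V
    x = proj₁ X
    balanced = balanced-exchange-pair u v x (∣A∣≡∣B∣ U V) same-meet (subst (0 <_) (sym ∣u∖v∣≡1+d) z<s)
    open ExchangePair (proj₁ balanced)
    X-fixed : lookup x i ≡ lookup x j
    X-fixed = proj₂ balanced
    u′ = swap i j u
    closer : ∣ u′ ∩ ∁ v ∣ ≡ d
    closer = suc-injective (begin
      suc ∣ u′ ∩ ∁ v ∣                 ≡⟨ +-comm 1 _ ⟩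
      ∣ u′ ∩ ∁ v ∣ + ⟦ not false ⟧     ≡⟨ cong (λ b → ∣ u′ ∩ ∁ v ∣ + ⟦ not b ⟧) i∉q ⟨
      ∣ u′ ∩ ∁ v ∣ + ⟦ not (lookup v i) ⟧
                                       ≡⟨ cong (λ b → ∣ u′ ∩ ∁ v ∣ + ⟦ b ⟧) (lookup-∁ v i) ⟨
      ∣ u′ ∩ ∁ v ∣ + ⟦ lookup (∁ v) i ⟧ ≡⟨ exchange-count u (∁ v) i∈p j∉p ⟩
      ∣ u ∩ ∁ v ∣ + ⟦ lookup (∁ v) j ⟧ ≡⟨ cong (λ b → ∣ u ∩ ∁ v ∣ + ⟦ b ⟧) (lookup-∁ v j) ⟩
      ∣ u ∩ ∁ v ∣ + ⟦ not (lookup v j) ⟧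
                                       ≡⟨ cong (λ b → ∣ u ∩ ∁ v ∣ + ⟦ not b ⟧) j∈q ⟩
      ∣ u ∩ ∁ v ∣ + 0                  ≡⟨ +-identityʳ _ ⟩
      ∣ u ∩ ∁ v ∣                      ≡⟨ ∣u∖v∣≡1+d ⟩
      suc d                            ∎)
    same-meet′ : ∣ u′ ∩ x ∣ ≡ ∣ v ∩ x ∣
    same-meet′ = trans (+-cancelʳ-≡ ⟦ lookup x i ⟧ _ _ (begin
      ∣ u′ ∩ x ∣ + ⟦ lookup x i ⟧ ≡⟨ exchange-count u x i∈p j∉p ⟩
      ∣ u ∩ x ∣ + ⟦ lookup x j ⟧  ≡⟨ cong (λ b → ∣ u ∩ x ∣ + ⟦ b ⟧) X-fixed ⟨
      ∣ u ∩ x ∣ + ⟦ lookup x i ⟧  ∎)) same-meet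

  kneser-equidistant : {U V X : KSubset n k} {m : ℕ} → ∣ proj₁ U ∩ proj₁ X ∣ ≡ ∣ proj₁ V ∩ proj₁ X ∣ →
                       Dist (Kneser n k) U X m → Dist (Kneser n k) V X m
  kneser-equidistant {U} {V} {X} = kneser-equidistant-by _ U V X refl

-- If x resolves u, v in K(n,k) but d_J(u,x) = d_J(v,x), then
-- ∣ u ∩ x ∣ = ∣ v ∩ x ∣, so u and v have the same Kneser distance to x (which
-- exists, K(n,k) being connected): a contradiction.
lemma1p2 : (n k : ℕ) → 1 ≤ k → 2 * k < n →
    ((S : List (KSubset n k)) → IsResolving (Kneser n k) S → IsResolving (Johnson n k) S)
    × ((bJ bK : ℕ) → IsMetricDim (Johnson n k) bJ → IsMetricDim (Kneser n k) bK → bJ ≤ bK)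
lemma1p2 n k _ 2k<n = kneser⇒johnson , dimension-bound
  where
  kneser⇒johnson : (S : List (KSubset n k)) → IsResolving (Kneser n k) S → IsResolving (Johnson n k) S
  kneser⇒johnson S resolving u v u≢v =
    let x , x∈S , x-resolves-K = resolving u v u≢v in
    x , x∈S , λ { a .a dᵤ dᵥ refl →
      walk⇒¬¬dist (Kneser n k) (proj₂ (kneser-connected 2k<n u x)) λ (m , dK) →
        x-resolves-K m m dK (kneser-equidistant (johnson-same-meet dᵤ dᵥ) dK) refl }
  dimension-bound : (bJ bK : ℕ) → IsMetricDim (Johnson n k) bJ → IsMetricDim (Kneser n k) bK → bJ ≤ bK
  dimension-bound bJ bK (_ , J-minimal) ((S , unique , resolving , ∣S∣≡bK) , _) =
    subst (bJ ≤_) ∣S∣≡bK (J-minimal S unique (kneser⇒johnson S resolving))
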